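{- Let $U_1,U_2\le G$ be such that, for $i\in\{1,2\}$, $U_i=Z_i\times R_i$ with $Z_i\le S_h\times S_n$ and $R_i\le\Omega$. Then a social preference correspondence is both $U_1$-consistent and $U_2$-consistent if and only if it is $\langle U_1,U_2\rangle$-consistent; and, for each $k\in\{1,\dots,n-1\}$, a $k$-multiwinner social choice correspondence is both $U_1$-consistent and $U_2$-consistent if and only if it is $\langle U_1,U_2\rangle$-consistent. Here $\langle U_1,U_2\rangle$ is the subgroup of $G$ generated by $U_1$ and $U_2$.
   Context: Let $n,h\ge 2$ be integers, $N=\{1,\dots,n\}$. $S_m$ is the symmetric group on $\{1,\dots,m\}$ with product $(\sigma\tau)(x)=\sigma(\tau(x))$. $\mathbf L(N)$ is the set of linear orders on $N$; a linear order $q$ with $q(1)\succ\dots\succ q(n)$ is identified with the permutation $r\mapsto q(r)$ in $S_n$. Let $\rho_0(r)=n-r+1$, $\Omega=\{id,\rho_0\}\le S_n$. $\mathcal P=\mathbf L(N)^h$. $G=S_h\times S_n\times\Omega$; $p^{(\varphi,\psi,\rho)}$ is the profile with $i$-th component $\psi p_{\varphi^{ -1}(i)}\rho$. A social preference correspondence assigns to each $p$ a subset $C(p)\subseteq\mathbf L(N)$; a $k$-multiwinner social choice correspondence assigns to each $p$ a set $C(p)$ of $k$-subsets of $N$. For $\psi\in S_n$: $\psi X=\{\psi q:q\in X\}$ for sets of linear orders and $\psi\mathbb W=\{\psi(W):W\in\mathbb W\}$ for families of subsets. For $U\le G$, $C$ is $U$-consistent if for all $p$ and $(\varphi,\psi,\rho)\in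 U$: $C(p^{(\varphi,\psi,\rho)})=\psi C(p)$ if $\rho=id$, and $C(p^{(\varphi,\psi,\rho)})\ne\psi C(p)$ if $\rho=\rho_0$ and $|C(p)|=1$. -}

module Defs where

open import Level using (Level) renaming (zero to 0ℓ; suc to lsuc)
open import Data.Nat using (ℕ)
open import Data.Fin using (Fin; opposite; _≟_)
open import Data.Fin.Properties using (any?)
open import Data.Fin.Subset using (Subset)
open import Data.Vec using (Vec; lookup; tabulate; allFin)
open import Data.Product using (Σ; ∃; _×_; _,_)
open import Data.Sum using (_⊎_)
open import Relation.Nullary using (¬_; yes; no)
open import Relation.Unary using (Pred; _⊆_; _≐_)
open import Relation.Binary.PropositionalEquality using (_≡_)

private variable
  n h : ℕ
  ℓ : Level

-- An element of S_m is represented by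
-- the vector of its values; 0-based: alternative r+1 is Fin index r.
-- A linear order q with q(1) ≻ … ≻ q(n) is the vector r ↦ q(r).

Ord : ℕ → Set
Ord n = Vec (Fin n) n

-- validity: the vector is a permutation (injective, hence bijective)
IsPerm : Ord n → Set
IsPerm σ = ∀ i j → lookup σ i ≡ lookup σ j → i ≡ j

_∘ᵥ_ : Ord n → Ord n → Ord n
σ ∘ᵥ τ = tabulate (λ x → lookup σ (lookup τ x))

idᵥ : Ord n
idᵥ = allFin _

-- ρ₀(r) = n - r + 1   (0-based: i ↦ n - 1 - i)
ρ₀ : Ord n
ρ₀ = tabulate opposite

invAt : Ord n → Fin n → Fin n
invAt σ y with any? (λ x → lookup σ x ≟ y)
... | yes (x , _) = x
... | no _ = y

inv : Ord n → Ord n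
inv σ = tabulate (invAt σ)

record IsSubgroup {A : Set} (Valid : Pred A 0ℓ) (_∙_ : A → A → A) (e : A)
                  (V : Pred A ℓ) : Set ℓ where
  field
    valid   : ∀ {x} → V x → Valid x
    unit    : V e
    mul     : ∀ {x y} → V x → V y → V (x ∙ y)
    inverse : ∀ {x} → V x → ∃ λ y → V y × (x ∙ y ≡ e) × (y ∙ x ≡ e)

SHN : ℕ → ℕ → Set
SHN h n = Ord h × Ord n

ValidSHN : Pred (SHN h n) 0ℓ
ValidSHN (φ , ψ) = IsPerm φ × IsPerm ψ

_∙SHN_ : SHN h n → SHN h n → SHN h n
(φ , ψ) ∙SHN (φ' , ψ') = (φ ∘ᵥ φ') , (ψ ∘ᵥ ψ')

eSHN : SHN h n
eSHN = idᵥ , idᵥ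

IsSubgroupSHN : Pred (SHN h n) ℓ → Set ℓ
IsSubgroupSHN = IsSubgroup ValidSHN _∙SHN_ eSHN

InΩ : Pred (Ord n) 0ℓ
InΩ ρ = (ρ ≡ idᵥ) ⊎ (ρ ≡ ρ₀)

IsSubgroupΩ : Pred (Ord n) ℓ → Set ℓ
IsSubgroupΩ = IsSubgroup InΩ _∘ᵥ_ idᵥ

GG : ℕ → ℕ → Set
GG h n = Ord h × Ord n × Ord n

ValidG : Pred (GG h n) 0ℓ
ValidG (φ , ψ , ρ) = IsPerm φ × IsPerm ψ × InΩ ρ

_∙G_ : GG h n → GG h n → GG h n
(φ , ψ , ρ) ∙G (φ' , ψ' , ρ') = (φ ∘ᵥ φ') , (ψ ∘ᵥ ψ') , (ρ ∘ᵥ ρ')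

eG : GG h n
eG = idᵥ , idᵥ , idᵥ

IsSubgroupG : Pred (GG h n) ℓ → Set ℓ
IsSubgroupG = IsSubgroup ValidG _∙G_ eG

_⊗_ : Pred (SHN h n) 0ℓ → Pred (Ord n) 0ℓ → Pred (GG h n) 0ℓ
(Z ⊗ R) (φ , ψ , ρ) = Z (φ , ψ) × R ρ

⟨_,_⟩ : Pred (GG h n) 0ℓ → Pred (GG h n) 0ℓ → Pred (GG h n) (lsuc 0ℓ)
⟨ U₁ , U₂ ⟩ g = ∀ (V : Pred _ 0ℓ) → IsSubgroupG V → U₁ ⊆ V → U₂ ⊆ V → V g

Profile : ℕ → ℕ → Set
Profile h n = Vec (Ord n) h

ValidProfile : Pred (Profile h n) 0ℓ
ValidProfile p = ∀ i → IsPerm (lookup p i)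

act : GG h n → Profile h n → Profile h n
act (φ , ψ , ρ) p = tabulate (λ i → ψ ∘ᵥ (lookup p (lookup (inv φ) i) ∘ᵥ ρ))

IsSPC : (Profile h n → Pred (Ord n) 0ℓ) → Set
IsSPC C = ∀ p → ValidProfile p → ∀ q → C p q → IsPerm q

IsMSCC : ℕ → (Profile h n → Pred (Subset n) 0ℓ) → Set
IsMSCC {n = n} k C = ∀ p → ValidProfile p → ∀ W → C p W → Data.Fin.Subset.∣ W ∣ ≡ k

imgOrd : Ord n → Pred (Ord n) 0ℓ → Pred (Ord n) 0ℓ
imgOrd ψ X r = ∃ λ q → X q × (r ≡ ψ ∘ᵥ q)

-- ψ(W) = { ψ(x) : x ∈ W }  (for a permutation ψ: y ∈ ψ(W) iff ψ⁻¹(y) ∈ W)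
imgSub : Ord n → Subset n → Subset n
imgSub ψ W = tabulate (λ y → lookup W (lookup (inv ψ) y))

imgFam : Ord n → Pred (Subset n) 0ℓ → Pred (Subset n) 0ℓ
imgFam ψ 𝕎 V = ∃ λ W → 𝕎 W × (V ≡ imgSub ψ W)

IsSingleton : {O : Set} → Pred O 0ℓ → Set
IsSingleton X = ∃ λ x → X x × (∀ y → X y → y ≡ x)

Consistent : {O : Set} → (Ord n → Pred O 0ℓ → Pred O 0ℓ) →
             Pred (GG h n) ℓ → (Profile h n → Pred O 0ℓ) → Set ℓ
Consistent img U C =
  ∀ p → ValidProfile p → ∀ φ ψ ρ → U (φ , ψ , ρ) →
    (ρ ≡ idᵥ → C (act (φ , ψ , ρ) p) ≐ img ψ (C p)) ×
    (ρ ≡ ρ₀ → IsSingleton (C p) → ¬ (C (act (φ , ψ , ρ) p) ≐ img ψ (C p)))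

module Submission where

open import Defs
open import Level using (Level) renaming (zero to 0ℓ)
open import Data.Nat using (ℕ; _≤_; _∸_; zero; suc; s≤s)
open import Data.Nat.Properties using (n<1+n)
open import Data.Fin using (Fin; opposite; _≟_; punchOut)
import Data.Fin as Fin
open import Data.Fin.Properties using (any?; pigeonhole; punchOut-injective; opposite-involutive; <⇒≢)
open import Data.Fin.Subset using (Subset)
open import Data.Vec using (Vec; lookup)
open import Data.Vec.Properties using (lookup∘tabulate; tabulate∘lookup; tabulate-cong; lookup-allFin)
open import Data.Product using (_×_; _,_; proj₁; proj₂; ∃)
open import Data.Sum using (_⊎_; inj₁; inj₂)
open import Data.Empty using (⊥-elim)
open import Relation.Nullary using (¬_; yes; no)
open import Relation.Unary using (Pred; _⊆_; _≐_)
open import Relation.Unary.Properties using (≐-sym; ≐-trans)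
open import Relation.Binary.PropositionalEquality
open import Function.Bundles using (_⇔_; mk⇔)

-- Fix an outcome type O on which S_n acts (linear orders by
-- left multiplication, k-subsets by direct image) and a correspondence C.
-- Collect all elements of G that C "respects" into one set Sym C:
-- (φ,ψ,ρ) ∈ Sym C iff (φ,ψ) is an equivariance of C (C(p^(φ,ψ,id)) = ψC(p))
-- and ρ = id, or ρ = ρ₀ and C never commutes with full reversal of a
-- profile that has a unique outcome.  Then
--   (1) Sym C is a subgroup of G;
--   (2) every element of Sym C satisfies the consistency conditions —
--       for ρ = ρ₀ this is because p^(φ,ψ,ρ₀) = (p^(id,id,ρ₀))^(φ,ψ,id);
--   (3) if U = Z × R is a subgroup of product form and C is U-consistent
--       then U ⊆ Sym C (U contains (φ,ψ,id) and (id,id,ρ) for (φ,ψ,ρ) ∈ U).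
-- Hence U₁- and U₂-consistency give ⟨U₁,U₂⟩ ⊆ Sym C, so C is
-- ⟨U₁,U₂⟩-consistent; the converse is monotonicity of consistency.

private variable
  n h : ℕ

-- A proof that σ is a permutation, packaged so that σ is inferable.
record Perm (σ : Ord n) : Set where
  constructor perm
  field injective : IsPerm σ
open Perm

vec-ext : {A : Set} {u v : Vec A n} → (∀ i → lookup u i ≡ lookup v i) → u ≡ v
vec-ext {u = u} {v} u≗v =
  trans (sym (tabulate∘lookup u)) (trans (tabulate-cong u≗v) (tabulate∘lookup v))

lookup-∘ : (σ τ : Ord n) (x : Fin n) → lookup (σ ∘ᵥ τ) x ≡ lookup σ (lookup τ x)
lookup-∘ σ τ = lookup∘tabulate _

lookup-id : (x : Fin n) → lookup (idᵥ {n}) x ≡ x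
lookup-id = lookup-allFin

lookup-inv : (σ : Ord n) (y : Fin n) → lookup (inv σ) y ≡ invAt σ y
lookup-inv σ = lookup∘tabulate _

lookup-ρ₀ : (x : Fin n) → lookup (ρ₀ {n}) x ≡ opposite x
lookup-ρ₀ = lookup∘tabulate _

∘-assoc : (σ τ υ : Ord n) → (σ ∘ᵥ τ) ∘ᵥ υ ≡ σ ∘ᵥ (τ ∘ᵥ υ)
∘-assoc σ τ υ = vec-ext λ x → begin
  lookup ((σ ∘ᵥ τ) ∘ᵥ υ) x        ≡⟨ lookup-∘ (σ ∘ᵥ τ) υ x ⟩
  lookup (σ ∘ᵥ τ) (lookup υ x)    ≡⟨ lookup-∘ σ τ _ ⟩
  lookup σ (lookup τ (lookup υ x)) ≡⟨ cong (lookup σ) (lookup-∘ τ υ x) ⟨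
  lookup σ (lookup (τ ∘ᵥ υ) x)    ≡⟨ lookup-∘ σ (τ ∘ᵥ υ) x ⟨
  lookup (σ ∘ᵥ (τ ∘ᵥ υ)) x        ∎
  where open ≡-Reasoning

∘-identityˡ : (σ : Ord n) → idᵥ ∘ᵥ σ ≡ σ
∘-identityˡ σ = vec-ext λ x → trans (lookup-∘ idᵥ σ x) (lookup-id _)

∘-identityʳ : (σ : Ord n) → σ ∘ᵥ idᵥ ≡ σ
∘-identityʳ σ = vec-ext λ x → trans (lookup-∘ σ idᵥ x) (cong (lookup σ) (lookup-id x))

perm-id : Perm (idᵥ {n})
injective perm-id i j e = trans (sym (lookup-id i)) (trans e (lookup-id j))

perm-∘ : {σ τ : Ord n} → Perm σ → Perm τ → Perm (σ ∘ᵥ τ)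
injective (perm-∘ {σ = σ} {τ} Pσ Pτ) i j e =
  injective Pτ i j (injective Pσ _ _ (trans (sym (lookup-∘ σ τ i)) (trans e (lookup-∘ σ τ j))))

-- An injective self-map of Fin n is surjective: otherwise, punching out
-- the missed value y gives an injection Fin (1+m) → Fin m.
perm-surjective : {σ : Ord n} → Perm σ → ∀ y → ∃ λ x → lookup σ x ≡ y
perm-surjective {zero} _ ()
perm-surjective {suc m} {σ} Pσ y with any? (λ x → lookup σ x ≟ y)
... | yes hit = hit
... | no miss = ⊥-elim (<⇒≢ i<j (injective Pσ i j (punchOut-injective (y≢ i) (y≢ j) collide)))
  where
  y≢ : ∀ x → y ≢ lookup σ x
  y≢ x e = miss (x , sym e)
  hole = pigeonhole (n<1+n m) (λ x → punchOut (y≢ x))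
  i = proj₁ hole
  j = proj₁ (proj₂ hole)
  i<j = proj₁ (proj₂ (proj₂ hole))
  collide = proj₂ (proj₂ (proj₂ hole))

invAt-inverseʳ : {σ : Ord n} → Perm σ → ∀ y → lookup σ (invAt σ y) ≡ y
invAt-inverseʳ {σ = σ} Pσ y with any? (λ x → lookup σ x ≟ y)
... | yes (_ , e) = e
... | no miss = ⊥-elim (miss (perm-surjective Pσ y))

invAt-unique : {σ : Ord n} → Perm σ → ∀ {x y} → lookup σ x ≡ y → invAt σ y ≡ x
invAt-unique Pσ {x} {y} e = injective Pσ _ _ (trans (invAt-inverseʳ Pσ y) (sym e))

invAt-id : (y : Fin n) → invAt idᵥ y ≡ y
invAt-id y = invAt-unique perm-id (lookup-id y)

invAt-∘ : {σ τ : Ord n} → Perm σ → Perm τ → ∀ y → invAt (σ ∘ᵥ τ) y ≡ invAt τ (invAt σ y)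
invAt-∘ {σ = σ} {τ} Pσ Pτ y = invAt-unique (perm-∘ Pσ Pτ) (begin
  lookup (σ ∘ᵥ τ) (invAt τ (invAt σ y))    ≡⟨ lookup-∘ σ τ _ ⟩
  lookup σ (lookup τ (invAt τ (invAt σ y))) ≡⟨ cong (lookup σ) (invAt-inverseʳ Pτ _) ⟩
  lookup σ (invAt σ y)                      ≡⟨ invAt-inverseʳ Pσ y ⟩
  y                                         ∎)
  where open ≡-Reasoning

perm-inv : {σ : Ord n} → Perm σ → Perm (inv σ)
injective (perm-inv {σ = σ} Pσ) i j e = begin
  i                    ≡⟨ invAt-inverseʳ Pσ i ⟨
  lookup σ (invAt σ i) ≡⟨ cong (lookup σ) (trans (sym (lookup-inv σ i)) (trans e (lookup-inv σ j))) ⟩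
  lookup σ (invAt σ j) ≡⟨ invAt-inverseʳ Pσ j ⟩
  j                    ∎
  where open ≡-Reasoning

inv-inverseʳ : {σ : Ord n} → Perm σ → σ ∘ᵥ inv σ ≡ idᵥ
inv-inverseʳ {σ = σ} Pσ = vec-ext λ x → begin
  lookup (σ ∘ᵥ inv σ) x ≡⟨ lookup-∘ σ (inv σ) x ⟩
  lookup σ (lookup (inv σ) x) ≡⟨ cong (lookup σ) (lookup-inv σ x) ⟩
  lookup σ (invAt σ x) ≡⟨ invAt-inverseʳ Pσ x ⟩
  x ≡⟨ lookup-id x ⟨
  lookup idᵥ x ∎
  where open ≡-Reasoning

inv-inverseˡ : {σ : Ord n} → Perm σ → inv σ ∘ᵥ σ ≡ idᵥ
inv-inverseˡ {σ = σ} Pσ = vec-ext λ x → begin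
  lookup (inv σ ∘ᵥ σ) x ≡⟨ lookup-∘ (inv σ) σ x ⟩
  lookup (inv σ) (lookup σ x) ≡⟨ lookup-inv σ _ ⟩
  invAt σ (lookup σ x) ≡⟨ invAt-unique Pσ refl ⟩
  x ≡⟨ lookup-id x ⟨
  lookup idᵥ x ∎
  where open ≡-Reasoning

perm-ρ₀ : Perm (ρ₀ {n})
injective perm-ρ₀ i j e = begin
  i                   ≡⟨ opposite-involutive i ⟨
  opposite (opposite i) ≡⟨ cong opposite (trans (sym (lookup-ρ₀ i)) (trans e (lookup-ρ₀ j))) ⟩
  opposite (opposite j) ≡⟨ opposite-involutive j ⟩
  j                   ∎
  where open ≡-Reasoning

ρ₀-involutive : ρ₀ {n} ∘ᵥ ρ₀ ≡ idᵥ
ρ₀-involutive = vec-ext λ x → begin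
  lookup (ρ₀ ∘ᵥ ρ₀) x ≡⟨ lookup-∘ ρ₀ ρ₀ x ⟩
  lookup ρ₀ (lookup ρ₀ x) ≡⟨ lookup-ρ₀ _ ⟩
  opposite (lookup ρ₀ x) ≡⟨ cong opposite (lookup-ρ₀ x) ⟩
  opposite (opposite x) ≡⟨ opposite-involutive x ⟩
  x ≡⟨ lookup-id x ⟨
  lookup idᵥ x ∎
  where open ≡-Reasoning

-- With at least two alternatives reversal is not the identity:
-- it sends the first alternative to the last one.
ρ₀≢id : 2 ≤ n → ρ₀ {n} ≢ idᵥ
ρ₀≢id {suc zero} (s≤s ()) _
ρ₀≢id {suc (suc _)} _ ρ₀≡id with cong (λ v → lookup v Fin.zero) ρ₀≡id
... | ()

Ω-involutive : {ρ : Ord n} → InΩ ρ → ρ ∘ᵥ ρ ≡ idᵥ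
Ω-involutive (inj₁ refl) = ∘-identityˡ idᵥ
Ω-involutive (inj₂ refl) = ρ₀-involutive

Ω-mul : {ρ ρ′ : Ord n} → InΩ ρ → InΩ ρ′ → InΩ (ρ ∘ᵥ ρ′)
Ω-mul (inj₁ refl) ρ′∈Ω = subst InΩ (sym (∘-identityˡ _)) ρ′∈Ω
Ω-mul (inj₂ refl) (inj₁ refl) = inj₂ (∘-identityʳ _)
Ω-mul (inj₂ refl) (inj₂ refl) = inj₁ ρ₀-involutive

act-lookup : (φ : Ord h) (ψ ρ : Ord n) (p : Profile h n) (i : Fin h) →
  lookup (act (φ , ψ , ρ) p) i ≡ ψ ∘ᵥ (lookup p (invAt φ i) ∘ᵥ ρ)
act-lookup φ ψ ρ p i =
  trans (lookup∘tabulate _ i) (cong (λ j → ψ ∘ᵥ (lookup p j ∘ᵥ ρ)) (lookup-inv φ i))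

act-cong : {φ φ′ : Ord h} {ψ ψ′ ρ ρ′ : Ord n} (p : Profile h n) →
  φ ≡ φ′ → ψ ≡ ψ′ → ρ ≡ ρ′ → act (φ , ψ , ρ) p ≡ act (φ′ , ψ′ , ρ′) p
act-cong p refl refl refl = refl

-- Action law.  The ρ-components compose in reverse order (ρ acts on the
-- right); for the abelian group Ω this is immaterial.
act-∘ : {φ φ′ : Ord h} (ψ ψ′ ρ ρ′ : Ord n) (p : Profile h n) → Perm φ → Perm φ′ →
  act (φ , ψ , ρ) (act (φ′ , ψ′ , ρ′) p) ≡ act ((φ ∘ᵥ φ′) , (ψ ∘ᵥ ψ′) , (ρ′ ∘ᵥ ρ)) p
act-∘ {φ = φ} {φ′} ψ ψ′ ρ ρ′ p Pφ Pφ′ = vec-ext pointwise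
  where
  open ≡-Reasoning
  regroup : (a b c d e : Ord n) → a ∘ᵥ ((b ∘ᵥ (c ∘ᵥ d)) ∘ᵥ e) ≡ (a ∘ᵥ b) ∘ᵥ (c ∘ᵥ (d ∘ᵥ e))
  regroup a b c d e = begin
    a ∘ᵥ ((b ∘ᵥ (c ∘ᵥ d)) ∘ᵥ e) ≡⟨ cong (a ∘ᵥ_) (∘-assoc b (c ∘ᵥ d) e) ⟩
    a ∘ᵥ (b ∘ᵥ ((c ∘ᵥ d) ∘ᵥ e)) ≡⟨ cong (λ v → a ∘ᵥ (b ∘ᵥ v)) (∘-assoc c d e) ⟩
    a ∘ᵥ (b ∘ᵥ (c ∘ᵥ (d ∘ᵥ e))) ≡⟨ ∘-assoc a b (c ∘ᵥ (d ∘ᵥ e)) ⟨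
    (a ∘ᵥ b) ∘ᵥ (c ∘ᵥ (d ∘ᵥ e)) ∎
  pointwise : ∀ i → lookup (act (φ , ψ , ρ) (act (φ′ , ψ′ , ρ′) p)) i
                  ≡ lookup (act ((φ ∘ᵥ φ′) , (ψ ∘ᵥ ψ′) , (ρ′ ∘ᵥ ρ)) p) i
  pointwise i = begin
    lookup (act (φ , ψ , ρ) (act (φ′ , ψ′ , ρ′) p)) i
      ≡⟨ act-lookup φ ψ ρ (act (φ′ , ψ′ , ρ′) p) i ⟩
    ψ ∘ᵥ (lookup (act (φ′ , ψ′ , ρ′) p) (invAt φ i) ∘ᵥ ρ)
      ≡⟨ cong (λ v → ψ ∘ᵥ (v ∘ᵥ ρ)) (act-lookup φ′ ψ′ ρ′ p _) ⟩
    ψ ∘ᵥ ((ψ′ ∘ᵥ (q ∘ᵥ ρ′)) ∘ᵥ ρ)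
      ≡⟨ regroup ψ ψ′ q ρ′ ρ ⟩
    (ψ ∘ᵥ ψ′) ∘ᵥ (q ∘ᵥ (ρ′ ∘ᵥ ρ))
      ≡⟨ cong (λ j → (ψ ∘ᵥ ψ′) ∘ᵥ (lookup p j ∘ᵥ (ρ′ ∘ᵥ ρ))) (invAt-∘ Pφ Pφ′ i) ⟨
    (ψ ∘ᵥ ψ′) ∘ᵥ (lookup p (invAt (φ ∘ᵥ φ′) i) ∘ᵥ (ρ′ ∘ᵥ ρ))
      ≡⟨ act-lookup (φ ∘ᵥ φ′) (ψ ∘ᵥ ψ′) (ρ′ ∘ᵥ ρ) p i ⟨
    lookup (act ((φ ∘ᵥ φ′) , (ψ ∘ᵥ ψ′) , (ρ′ ∘ᵥ ρ)) p) i ∎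
    where q = lookup p (invAt φ′ (invAt φ i))

act-identity : (p : Profile h n) → act eG p ≡ p
act-identity p = vec-ext λ i → begin
  lookup (act eG p) i                      ≡⟨ act-lookup idᵥ idᵥ idᵥ p i ⟩
  idᵥ ∘ᵥ (lookup p (invAt idᵥ i) ∘ᵥ idᵥ) ≡⟨ ∘-identityˡ _ ⟩
  lookup p (invAt idᵥ i) ∘ᵥ idᵥ          ≡⟨ ∘-identityʳ _ ⟩
  lookup p (invAt idᵥ i)                  ≡⟨ cong (lookup p) (invAt-id i) ⟩
  lookup p i                              ∎
  where open ≡-Reasoning

act-valid : (φ : Ord h) {ψ ρ : Ord n} (p : Profile h n) → Perm ψ → Perm ρ →
  ValidProfile p → ValidProfile (act (φ , ψ , ρ) p)
act-valid φ {ψ} {ρ} p Pψ Pρ valid-p i =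
  subst IsPerm (sym (act-lookup φ ψ ρ p i))
    (injective (perm-∘ Pψ (perm-∘ (perm {σ = lookup p (invAt φ i)} (valid-p _)) Pρ)))

consistent-antitone : {O : Set} {img : Ord n → Pred O 0ℓ → Pred O 0ℓ}
  {ℓ ℓ′ : Level} {U : Pred (GG h n) ℓ} {U′ : Pred (GG h n) ℓ′} {C : Profile h n → Pred O 0ℓ} →
  U ⊆ U′ → Consistent img U′ C → Consistent img U C
consistent-antitone U⊆U′ consistent p valid-p φ ψ ρ g∈U = consistent p valid-p φ ψ ρ (U⊆U′ g∈U)

generated-upperˡ : {U₁ U₂ : Pred (GG h n) 0ℓ} → U₁ ⊆ ⟨ U₁ , U₂ ⟩
generated-upperˡ g∈U₁ V _ U₁⊆V _ = U₁⊆V g∈U₁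

generated-upperʳ : {U₁ U₂ : Pred (GG h n) 0ℓ} → U₂ ⊆ ⟨ U₁ , U₂ ⟩
generated-upperʳ g∈U₂ V _ _ U₂⊆V = U₂⊆V g∈U₂

generated-least : {U₁ U₂ V : Pred (GG h n) 0ℓ} →
  IsSubgroupG V → U₁ ⊆ V → U₂ ⊆ V → ⟨ U₁ , U₂ ⟩ ⊆ V
generated-least {V = V} V-subgroup U₁⊆V U₂⊆V g∈⟨U₁,U₂⟩ = g∈⟨U₁,U₂⟩ V V-subgroup U₁⊆V U₂⊆V

module OnOutcomes {O : Set} (_·_ : Ord n → O → O)
  (·-identity : ∀ o → idᵥ · o ≡ o)
  (·-∘ : ∀ {ψ ψ′} → Perm ψ → Perm ψ′ → ∀ o → ψ · (ψ′ · o) ≡ (ψ ∘ᵥ ψ′) · o) where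

  img : Ord n → Pred O 0ℓ → Pred O 0ℓ
  img ψ X o′ = ∃ λ o → X o × (o′ ≡ ψ · o)

  img-cong : ∀ {ψ} {X Y : Pred O 0ℓ} → X ≐ Y → img ψ X ≐ img ψ Y
  img-cong (X⊆Y , Y⊆X) = (λ (o , o∈X , e) → o , X⊆Y o∈X , e)
                       , (λ (o , o∈Y , e) → o , Y⊆X o∈Y , e)

  img-identity : ∀ {X} → img idᵥ X ≐ X
  img-identity {X} = (λ { (o , o∈X , refl) → subst X (sym (·-identity o)) o∈X })
                   , (λ {o} o∈X → o , o∈X , sym (·-identity o))

  img-∘ : ∀ {ψ ψ′ X} → Perm ψ → Perm ψ′ → img ψ (img ψ′ X) ≐ img (ψ ∘ᵥ ψ′) X
  img-∘ Pψ Pψ′ = (λ { (_ , (o , o∈X , refl) , refl) → o , o∈X , ·-∘ Pψ Pψ′ o })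
               , (λ { (o , o∈X , refl) → _ , (o , o∈X , refl) , sym (·-∘ Pψ Pψ′ o) })

  img-cancel : ∀ {ψ X} → Perm ψ → img (inv ψ) (img ψ X) ≐ X
  img-cancel {ψ} {X} Pψ = ≐-trans (img-∘ (perm-inv Pψ) Pψ)
    (subst (λ σ → img σ X ≐ X) (sym (inv-inverseˡ Pψ)) img-identity)

  img-injective : ∀ {ψ X Y} → Perm ψ → img ψ X ≐ img ψ Y → X ≐ Y
  img-injective Pψ ψX≐ψY =
    ≐-trans (≐-sym (img-cancel Pψ)) (≐-trans (img-cong ψX≐ψY) (img-cancel Pψ))

  module Symmetries (C : Profile h n → Pred O 0ℓ) where

    Equivariance : SHN h n → Set
    Equivariance (φ , ψ) = ∀ p → ValidProfile p → C (act (φ , ψ , idᵥ) p) ≐ img ψ (C p)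

    ReversalBreaks : Set
    ReversalBreaks = ∀ p → ValidProfile p → IsSingleton (C p) →
      ¬ (C (act (idᵥ , idᵥ , ρ₀) p) ≐ C p)

    AdmissibleReversal : Ord n → Set
    AdmissibleReversal ρ = (ρ ≡ idᵥ) ⊎ ((ρ ≡ ρ₀) × ReversalBreaks)

    Sym : Pred (GG h n) 0ℓ
    Sym (φ , ψ , ρ) = ValidG (φ , ψ , ρ) × Equivariance (φ , ψ) × AdmissibleReversal ρ

    equivariance-unit : Equivariance eSHN
    equivariance-unit p _ =
      subst (λ q → C q ≐ img idᵥ (C p)) (sym (act-identity p)) (≐-sym img-identity)

    equivariance-mul : ∀ {φ ψ φ′ ψ′} → Perm φ → Perm ψ → Perm φ′ → Perm ψ′ →
      Equivariance (φ , ψ) → Equivariance (φ′ , ψ′) → Equivariance ((φ ∘ᵥ φ′) , (ψ ∘ᵥ ψ′))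
    equivariance-mul {φ} {ψ} {φ′} {ψ′} Pφ Pψ Pφ′ Pψ′ eq eq′ p valid-p =
      subst (λ q → C q ≐ img (ψ ∘ᵥ ψ′) (C p)) composite
        (≐-trans (eq _ (act-valid φ′ p Pψ′ perm-id valid-p))
          (≐-trans (img-cong (eq′ p valid-p)) (img-∘ Pψ Pψ′)))
      where
      composite : act (φ , ψ , idᵥ) (act (φ′ , ψ′ , idᵥ) p) ≡ act ((φ ∘ᵥ φ′) , (ψ ∘ᵥ ψ′) , idᵥ) p
      composite = trans (act-∘ ψ ψ′ idᵥ idᵥ p Pφ Pφ′) (cong (λ ρ → act ((φ ∘ᵥ φ′) , (ψ ∘ᵥ ψ′) , ρ) p) (∘-identityˡ idᵥ))

    -- Apply the equivariance to q = p^(φ⁻¹,ψ⁻¹,id), whose image under (φ,ψ,id) is p.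
    equivariance-inv : ∀ {φ ψ} → Perm φ → Perm ψ →
      Equivariance (φ , ψ) → Equivariance (inv φ , inv ψ)
    equivariance-inv {φ} {ψ} Pφ Pψ eq p valid-p =
      ≐-sym (≐-trans (img-cong Cp≐ψCq) (img-cancel Pψ))
      where
      q = act (inv φ , inv ψ , idᵥ) p
      back : act (φ , ψ , idᵥ) q ≡ p
      back = trans (act-∘ ψ (inv ψ) idᵥ idᵥ p Pφ (perm-inv Pφ))
        (trans (act-cong p (inv-inverseʳ Pφ) (inv-inverseʳ Pψ) (∘-identityˡ idᵥ)) (act-identity p))
      Cp≐ψCq : C p ≐ img ψ (C q)
      Cp≐ψCq = subst (λ r → C r ≐ img ψ (C q)) back
        (eq q (act-valid (inv φ) p (perm-inv Pψ) perm-id valid-p))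

    admissible-mul : ∀ {ρ ρ′} → AdmissibleReversal ρ → AdmissibleReversal ρ′ →
      AdmissibleReversal (ρ ∘ᵥ ρ′)
    admissible-mul (inj₁ refl) adm′ = subst AdmissibleReversal (sym (∘-identityˡ _)) adm′
    admissible-mul (inj₂ (refl , breaks)) (inj₁ refl) = inj₂ (∘-identityʳ _ , breaks)
    admissible-mul (inj₂ (refl , _)) (inj₂ (refl , _)) = inj₁ ρ₀-involutive

    Sym-subgroup : IsSubgroupG Sym
    Sym-subgroup = record
      { valid = proj₁
      ; unit = (injective perm-id , injective perm-id , inj₁ refl) , equivariance-unit , inj₁ refl
      ; mul = mul
      ; inverse = inverse
      }
      where
      mul : ∀ {g g′} → Sym g → Sym g′ → Sym (g ∙G g′)
      mul {φ , ψ , _} {φ′ , ψ′ , _} ((vφ , vψ , ρ∈Ω) , eq , adm) ((vφ′ , vψ′ , ρ′∈Ω) , eq′ , adm′) =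
        ( injective (perm-∘ Pφ Pφ′) , injective (perm-∘ Pψ Pψ′) , Ω-mul ρ∈Ω ρ′∈Ω)
        , equivariance-mul Pφ Pψ Pφ′ Pψ′ eq eq′
        , admissible-mul adm adm′
        where
        Pφ = perm {σ = φ} vφ
        Pψ = perm {σ = ψ} vψ
        Pφ′ = perm {σ = φ′} vφ′
        Pψ′ = perm {σ = ψ′} vψ′
      inverse : ∀ {g} → Sym g → ∃ λ g′ → Sym g′ × (g ∙G g′ ≡ eG) × (g′ ∙G g ≡ eG)
      inverse {φ , ψ , ρ} ((vφ , vψ , ρ∈Ω) , eq , adm) =
        (inv φ , inv ψ , ρ)
        , ((injective (perm-inv Pφ) , injective (perm-inv Pψ) , ρ∈Ω) , equivariance-inv Pφ Pψ eq , adm)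
        , cong₂ _,_ (inv-inverseʳ Pφ) (cong₂ _,_ (inv-inverseʳ Pψ) (Ω-involutive ρ∈Ω))
        , cong₂ _,_ (inv-inverseˡ Pφ) (cong₂ _,_ (inv-inverseˡ Pψ) (Ω-involutive ρ∈Ω))
        where
        Pφ = perm {σ = φ} vφ
        Pψ = perm {σ = ψ} vψ

    -- Since p^(φ,ψ,ρ₀) = (p^(id,id,ρ₀))^(φ,ψ,id), an equivariance (φ,ψ)
    -- commuting with the reversed action would make C commute with reversal.
    reversal-breaks-twisted : ∀ {φ ψ} → Perm φ → Perm ψ → Equivariance (φ , ψ) →
      ReversalBreaks → ∀ p → ValidProfile p → IsSingleton (C p) →
      ¬ (C (act (φ , ψ , ρ₀) p) ≐ img ψ (C p))
    reversal-breaks-twisted {φ} {ψ} Pφ Pψ eq breaks p valid-p single twisted =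
      breaks p valid-p single (img-injective Pψ (≐-trans (≐-sym ψCp′≐) twisted))
      where
      p′ = act (idᵥ , idᵥ , ρ₀) p
      split : act (φ , ψ , idᵥ) p′ ≡ act (φ , ψ , ρ₀) p
      split = trans (act-∘ ψ idᵥ idᵥ ρ₀ p Pφ perm-id)
        (act-cong p (∘-identityʳ φ) (∘-identityʳ ψ) (∘-identityʳ ρ₀))
      ψCp′≐ : C (act (φ , ψ , ρ₀) p) ≐ img ψ (C p′)
      ψCp′≐ = subst (λ r → C r ≐ img ψ (C p′)) split
        (eq p′ (act-valid idᵥ p perm-id perm-ρ₀ valid-p))

    Sym-consistent : 2 ≤ n → Consistent img Sym C
    Sym-consistent 2≤n p valid-p φ ψ ρ ((vφ , vψ , _) , eq , adm) =
      (λ { refl → eq p valid-p }) , reversed adm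
      where
      reversed : AdmissibleReversal ρ → ρ ≡ ρ₀ → IsSingleton (C p) →
        ¬ (C (act (φ , ψ , ρ) p) ≐ img ψ (C p))
      reversed (inj₁ ρ≡id) refl _ _ = ρ₀≢id 2≤n ρ≡id
      reversed (inj₂ (_ , breaks)) refl =
        reversal-breaks-twisted (perm {σ = φ} vφ) (perm {σ = ψ} vψ) eq breaks p valid-p

    -- (3) A product subgroup Z × R for which C is consistent consists of
    -- symmetries: it contains (φ,ψ,id) and (id,id,ρ) along with (φ,ψ,ρ).
    product-consistent⇒⊆Sym : ∀ {Z R} → IsSubgroupSHN Z → IsSubgroupΩ R →
      Consistent img (Z ⊗ R) C → Z ⊗ R ⊆ Sym
    product-consistent⇒⊆Sym {Z} {R} Z-subgroup R-subgroup consistent {φ , ψ , ρ} (z , r) =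
      (proj₁ (valid Z-subgroup z) , proj₂ (valid Z-subgroup z) , valid R-subgroup r)
      , (λ p valid-p → proj₁ (consistent p valid-p φ ψ idᵥ (z , unit R-subgroup)) refl)
      , admissible (valid R-subgroup r) r
      where
      open IsSubgroup
      admissible : ∀ {ρ} → InΩ ρ → R ρ → AdmissibleReversal ρ
      admissible (inj₁ ρ≡id) _ = inj₁ ρ≡id
      admissible (inj₂ refl) ρ₀∈R = inj₂ (refl , λ p valid-p single C′≐C →
        proj₂ (consistent p valid-p idᵥ idᵥ ρ₀ (unit Z-subgroup , ρ₀∈R)) refl single
          (≐-trans C′≐C (≐-sym img-identity)))

    consistency-generated : 2 ≤ n → ∀ {Z₁ Z₂ R₁ R₂} →
      IsSubgroupSHN Z₁ → IsSubgroupSHN Z₂ → IsSubgroupΩ R₁ → IsSubgroupΩ R₂ →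
      (Consistent img (Z₁ ⊗ R₁) C × Consistent img (Z₂ ⊗ R₂) C)
        ⇔ Consistent img ⟨ Z₁ ⊗ R₁ , Z₂ ⊗ R₂ ⟩ C
    consistency-generated 2≤n sZ₁ sZ₂ sR₁ sR₂ = mk⇔
      (λ (c₁ , c₂) → consistent-antitone {img = img}
        (generated-least Sym-subgroup (product-consistent⇒⊆Sym sZ₁ sR₁ c₁)
                                      (product-consistent⇒⊆Sym sZ₂ sR₂ c₂))
        (Sym-consistent 2≤n))
      (λ c → consistent-antitone {img = img} generated-upperˡ c
           , consistent-antitone {img = img} generated-upperʳ c)

imgSub-identity : (W : Subset n) → imgSub idᵥ W ≡ W
imgSub-identity W = vec-ext λ y → begin
  lookup (imgSub idᵥ W) y         ≡⟨ lookup∘tabulate _ y ⟩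
  lookup W (lookup (inv idᵥ) y)   ≡⟨ cong (lookup W) (trans (lookup-inv idᵥ y) (invAt-id y)) ⟩
  lookup W y                      ∎
  where open ≡-Reasoning

imgSub-∘ : {ψ ψ′ : Ord n} → Perm ψ → Perm ψ′ → ∀ W → imgSub ψ (imgSub ψ′ W) ≡ imgSub (ψ ∘ᵥ ψ′) W
imgSub-∘ {ψ = ψ} {ψ′} Pψ Pψ′ W = vec-ext λ y → begin
  lookup (imgSub ψ (imgSub ψ′ W)) y                 ≡⟨ lookup∘tabulate _ y ⟩
  lookup (imgSub ψ′ W) (lookup (inv ψ) y)            ≡⟨ lookup∘tabulate (λ z → lookup W (lookup (inv ψ′) z)) _ ⟩
  lookup W (lookup (inv ψ′) (lookup (inv ψ) y))      ≡⟨ cong (lookup W) (inverses y) ⟩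
  lookup W (lookup (inv (ψ ∘ᵥ ψ′)) y)                ≡⟨ lookup∘tabulate _ y ⟨
  lookup (imgSub (ψ ∘ᵥ ψ′) W) y                     ∎
  where
  open ≡-Reasoning
  inverses : ∀ y → lookup (inv ψ′) (lookup (inv ψ) y) ≡ lookup (inv (ψ ∘ᵥ ψ′)) y
  inverses y = begin
    lookup (inv ψ′) (lookup (inv ψ) y) ≡⟨ trans (lookup-inv ψ′ _) (cong (invAt ψ′) (lookup-inv ψ y)) ⟩
    invAt ψ′ (invAt ψ y)               ≡⟨ invAt-∘ Pψ Pψ′ y ⟨
    invAt (ψ ∘ᵥ ψ′) y                  ≡⟨ lookup-inv (ψ ∘ᵥ ψ′) y ⟨
    lookup (inv (ψ ∘ᵥ ψ′)) y           ∎

module OnOrders {n : ℕ} = OnOutcomes {n = n} _∘ᵥ_ ∘-identityˡ (λ {ψ} {ψ′} _ _ q → sym (∘-assoc ψ ψ′ q))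
module OnSubsets {n : ℕ} = OnOutcomes {n = n} imgSub imgSub-identity imgSub-∘

-- Proposition 3.  The result holds for any correspondence.

proposition3 : (n h : ℕ) → 2 ≤ n → 2 ≤ h →
    (Z₁ Z₂ : Pred (SHN h n) 0ℓ) (R₁ R₂ : Pred (Ord n) 0ℓ) →
    IsSubgroupSHN Z₁ → IsSubgroupSHN Z₂ → IsSubgroupΩ R₁ → IsSubgroupΩ R₂ →
    ((C : Profile h n → Pred (Ord n) 0ℓ) → IsSPC C →
      ((Consistent imgOrd (Z₁ ⊗ R₁) C × Consistent imgOrd (Z₂ ⊗ R₂) C)
        ⇔ Consistent imgOrd ⟨ Z₁ ⊗ R₁ , Z₂ ⊗ R₂ ⟩ C))
    ×
    ((k : ℕ) → 1 ≤ k → k ≤ n ∸ 1 → (C : Profile h n → Pred (Subset n) 0ℓ) → IsMSCC k C →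
      ((Consistent imgFam (Z₁ ⊗ R₁) C × Consistent imgFam (Z₂ ⊗ R₂) C)
        ⇔ Consistent imgFam ⟨ Z₁ ⊗ R₁ , Z₂ ⊗ R₂ ⟩ C))
proposition3 n h 2≤n _ Z₁ Z₂ R₁ R₂ sZ₁ sZ₂ sR₁ sR₂ =
  (λ C _ → OnOrders.Symmetries.consistency-generated C 2≤n sZ₁ sZ₂ sR₁ sR₂)
  , (λ k _ _ C _ → OnSubsets.Symmetries.consistency-generated C 2≤n sZ₁ sZ₂ sR₁ sR₂)
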